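{- Let $G$, $s$, $T$ and the labels $\ell(\cdot)$ be as produced by the Mark-up algorithm described in the context. Let $e\in E(T)$ and let $t$ be a vertex with $\ell(t)=e$. Then $d_{G-e}(s,t)<2\,d_G(s,t)$.
   Context: $G$ is an undirected 2-edge-connected graph with non-negative real edge weights, $s\in V(G)$, and $T$ is a fixed shortest-path tree of $G$ rooted at $s$. $d_H(x,y)$ is the shortest-path distance in $H$; $G-e$ is $G$ minus edge $e$. For $e=(u,v)\in E(T)$, $u$ is the parent of $v$; $T_v$ is the subtree of $T$ rooted at $v$; for $t\in V(T_v)$, $A(t,e)=V(\pi_T(v,t))$ is the set of vertices on the tree path from $v$ to $t$ (including $v$ and $t$); $P_e(t)$ is the path $\pi_{G-e}(s,v)\circ\pi_T(v,t)$, of weight $w(P_e(t))=d_{G-e}(s,v)+d_G(v,t)$. The total order $\prec$ on $E(T)$ is the order in which a preorder visit of $T$ from $s$ traverses the edges; a special label $\infty$ satisfies $e'\prec\infty$ for all $e'\in E(T)$. Mark-up algorithm: initially $\ell(x)=\infty$ for all vertices $x$. For each $e=(u,v)\in E(T)$ in order $\prec$, and for each $t\in V(T_v)$ in preorder of $T$: if $w(P_e(t))\le 2d_{G-e}(s,t)$ (distance test) do nothing; else if some $z\in A(t,e)$ has $\ell(z)\ne\infty$ (ancestor test) do nothing; otherwise set $\ell(t)\gets e$. -}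

module Defs where

open import Level using (0ℓ) renaming (suc to lsuc)
open import Data.Nat using (ℕ) renaming (_<_ to _<ℕ_)
open import Data.Fin using (Fin)
open import Data.Fin.Properties using (_≟_)
open import Data.Maybe using (Maybe; just; nothing)
open import Data.Product using (Σ; _×_; _,_; ∃)
open import Data.Sum using (_⊎_)
open import Data.Unit using (⊤)
open import Data.List using (List; []; _∷_; _++_)
open import Data.List.Membership.Propositional using (_∈_)
open import Data.List.Relation.Unary.Unique.Propositional using (Unique)
open import Relation.Nullary using (¬_; yes; no)
open import Relation.Binary.PropositionalEquality using (_≡_; _≢_)

-- Edge weights: a linearly ordered abelian group (e.g. the reals).
-- Equality is propositional equality.

record OrderedAbelianGroup : Set₁ where
  infixl 6 _+_
  infix 4 _≤_
  field
    Carrier   : Set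
    0#        : Carrier
    _+_       : Carrier → Carrier → Carrier
    -_        : Carrier → Carrier
    _≤_       : Carrier → Carrier → Set
    +-assoc   : ∀ x y z → (x + y) + z ≡ x + (y + z)
    +-comm    : ∀ x y → x + y ≡ y + x
    +-identityˡ : ∀ x → 0# + x ≡ x
    -‿inverseˡ : ∀ x → (- x) + x ≡ 0#
    ≤-refl    : ∀ {x} → x ≤ x
    ≤-trans   : ∀ {x y z} → x ≤ y → y ≤ z → x ≤ z
    ≤-antisym : ∀ {x y} → x ≤ y → y ≤ x → x ≡ y
    ≤-total   : ∀ x y → x ≤ y ⊎ y ≤ x
    +-monoˡ-≤ : ∀ {x y} z → x ≤ y → x + z ≤ y + z

  infix 4 _<_
  _<_ : Carrier → Carrier → Set
  x < y = x ≤ y × x ≢ y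

record Graph (W : OrderedAbelianGroup) : Set where
  open OrderedAbelianGroup W
  field
    n m    : ℕ
    ends   : Fin m → Fin n × Fin n
    weight : Fin m → Carrier

module _ {W : OrderedAbelianGroup} (G : Graph W) where
  open OrderedAbelianGroup W
  open Graph G

  V : Set
  V = Fin n

  Incident : Fin m → V → V → Set
  Incident i x y = ends i ≡ (x , y) ⊎ ends i ≡ (y , x)

  Simple : Set
  Simple = (∀ i x → ¬ Incident i x x)
         × (∀ i j x y → Incident i x y → Incident j x y → i ≡ j)

  NonNegWeights : Set
  NonNegWeights = ∀ i → 0# ≤ weight i

  -- Which edges are present: nothing = G itself, just e = G - e.
  Present : Maybe (Fin m) → Fin m → Set
  Present nothing  i = ⊤
  Present (just e) i = i ≢ e

  data Walk (a : Maybe (Fin m)) : V → V → Set where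
    []  : ∀ {x} → Walk a x x
    _∷_ : ∀ {x y z} → (Σ (Fin m) λ i → Present a i × Incident i x y)
          → Walk a y z → Walk a x z

  walkWeight : ∀ {a x y} → Walk a x y → Carrier
  walkWeight []              = 0#
  walkWeight ((i , _) ∷ p)   = weight i + walkWeight p

  Connected : Maybe (Fin m) → Set
  Connected a = ∀ x y → Walk a x y

  TwoEdgeConnected : Set
  TwoEdgeConnected = Connected nothing × (∀ e → Connected (just e))

  IsDist : Maybe (Fin m) → V → V → Carrier → Set
  IsDist a x y δ = (Σ (Walk a x y) λ p → walkWeight p ≡ δ)
                 × (∀ (p : Walk a x y) → δ ≤ walkWeight p)

  IsDistanceFunction : (Maybe (Fin m) → V → V → Carrier) → Set
  IsDistanceFunction D = ∀ a x y → IsDist a x y (D a x y)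

  -- Rooted spanning tree given by parent pointers:
  -- every v ≢ s has parent par v, joined to v by the tree edge pe v;
  -- a rank strictly decreasing towards the root ensures acyclicity.

  IsShortestPathTree : (D : Maybe (Fin m) → V → V → Carrier)
    → (s : V) → (par : V → V) → (pe : V → Fin m) → (rank : V → ℕ) → Set
  IsShortestPathTree D s par pe rank =
    ∀ v → v ≢ s →
      Incident (pe v) (par v) v
      × rank (par v) <ℕ rank v
      × D nothing s v ≡ D nothing s (par v) + weight (pe v)

  module Tree (s : V) (par : V → V) where

    Child : V → V → Set
    Child v c = c ≢ s × par c ≡ v

    data Desc (v : V) : V → Set where
      here : Desc v v
      step : ∀ {t} → t ≢ s → Desc v (par t) → Desc v t

    ChildrenList : V → List V → Set
    ChildrenList v cs = Unique cs
                      × (∀ c → c ∈ cs → Child v c)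
                      × (∀ c → Child v c → c ∈ cs)

    mutual
      data PreOrder (v : V) : List V → Set where
        visit : ∀ {cs L} → ChildrenList v cs → PreOrders cs L
                → PreOrder v (v ∷ L)

      data PreOrders : List V → List V → Set where
        []  : PreOrders [] []
        _∷_ : ∀ {c cs L Ls} → PreOrder c L → PreOrders cs Ls
              → PreOrders (c ∷ cs) (L ++ Ls)

    -- The Mark-up algorithm.  A label is  nothing  (= ∞) or  just v,
    -- standing for the tree edge e = (par v , v) = pe v.

    Labels : Set
    Labels = V → Maybe V

    _[_↦_] : Labels → V → Maybe V → Labels
    (ℓ [ t ↦ x ]) z with z ≟ t
    ... | yes _ = x
    ... | no  _ = ℓ z

    module Run (D : Maybe (Fin m) → V → V → Carrier) (pe : V → Fin m)
               (L : List V) where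

      wP : V → V → Carrier
      wP v t = D (just (pe v)) s v + D nothing v t

      DistTest : V → V → Set
      DistTest v t = wP v t ≤ D (just (pe v)) s t + D (just (pe v)) s t

      AncTest : Labels → V → V → Set
      AncTest ℓ v t = ∃ λ z → Desc v z × Desc z t × ℓ z ≢ nothing

      data Step (v t : V) : Labels → Labels → Set where
        dist : ∀ {ℓ} → DistTest v t → Step v t ℓ ℓ
        anc  : ∀ {ℓ} → ¬ DistTest v t → AncTest ℓ v t → Step v t ℓ ℓ
        mark : ∀ {ℓ} → ¬ DistTest v t → ¬ AncTest ℓ v t
               → Step v t ℓ (ℓ [ t ↦ just v ])

      -- for fixed e = pe v, scan the vertices t of T_v in preorder
      -- (ts is a suffix of the preorder list L; vertices outside T_v
      -- are skipped)
      data Inner (v : V) : Labels → List V → Labels → Set where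
        []   : ∀ {ℓ} → Inner v ℓ [] ℓ
        skip : ∀ {ℓ ℓ' t ts} → ¬ Desc v t → Inner v ℓ ts ℓ'
               → Inner v ℓ (t ∷ ts) ℓ'
        proc : ∀ {ℓ ℓ₁ ℓ' t ts} → Desc v t → Step v t ℓ ℓ₁
               → Inner v ℓ₁ ts ℓ' → Inner v ℓ (t ∷ ts) ℓ'

      -- scan the tree edges in the order ≺, i.e. by the preorder
      -- position of their child endpoint v (the root s has no edge)
      data Outer : Labels → List V → Labels → Set where
        []   : ∀ {ℓ} → Outer ℓ [] ℓ
        root : ∀ {ℓ ℓ' v vs} → v ≡ s → Outer ℓ vs ℓ'
               → Outer ℓ (v ∷ vs) ℓ'
        edge : ∀ {ℓ ℓ₁ ℓ' v vs} → v ≢ s → Inner v ℓ L ℓ₁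
               → Outer ℓ₁ vs ℓ' → Outer ℓ (v ∷ vs) ℓ'

      MarkUp : Labels → Set
      MarkUp ℓ = Outer (λ _ → nothing) L ℓ

-- A vertex t labelled by e = (u, v) lies in T_v and failed the distance test, so
-- w(P_e(t)) > 2 d_{G-e}(s,t). Let X be the weight of the tree path from v to t; then
-- d_G(s,t) = d_G(s,v) + X ≥ X. That path avoids e, so d_{G-e}(s,v) ≤ d_{G-e}(s,t) + X and
-- d_G(v,t) ≤ X, whence w(P_e(t)) ≤ d_{G-e}(s,t) + 2X. Were d_{G-e}(s,t) ≥ 2 d_G(s,t) ≥ 2X,
-- this would be at most 2 d_{G-e}(s,t), so the distance test would have succeeded.
module Submission where

open import Defs
open import Data.Nat using (ℕ)
open import Data.Fin using (Fin)
open import Data.Maybe using (Maybe; just; nothing)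
open import Data.List using (List)
open import Relation.Binary.PropositionalEquality using (_≡_; _≢_)

import Data.Nat as ℕ
import Data.Nat.Properties as ℕ
open import Data.Empty using (⊥; ⊥-elim)
open import Data.Product using (Σ; _×_; _,_; proj₁; proj₂)
open import Data.Product.Properties using (,-injectiveˡ; ,-injectiveʳ)
open import Data.Sum using (_⊎_; inj₁; inj₂)
open import Data.Unit using (tt)
open import Relation.Nullary using (¬_; yes; no)
open import Relation.Binary.PropositionalEquality
  using (refl; sym; trans; cong; cong₂; subst; module ≡-Reasoning)
open import Data.Fin.Properties using (_≟_)

module OrderedAbelianGroupProperties (W : OrderedAbelianGroup) where
  open OrderedAbelianGroup W

  +-identityʳ : ∀ x → x + 0# ≡ x
  +-identityʳ x = trans (+-comm x 0#) (+-identityˡ x)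

  ≤-respʳ-≡ : ∀ {x y z} → y ≡ z → x ≤ y → x ≤ z
  ≤-respʳ-≡ refl x≤y = x≤y

  ≤-respˡ-≡ : ∀ {x y z} → x ≡ y → x ≤ z → y ≤ z
  ≤-respˡ-≡ refl x≤z = x≤z

  +-monoʳ-≤ : ∀ {x y} z → x ≤ y → z + x ≤ z + y
  +-monoʳ-≤ {x} {y} z x≤y =
    ≤-respʳ-≡ (+-comm y z) (≤-respˡ-≡ (+-comm x z) (+-monoˡ-≤ z x≤y))

  +-mono-≤ : ∀ {x x′ y y′} → x ≤ x′ → y ≤ y′ → x + y ≤ x′ + y′
  +-mono-≤ {x′ = x′} {y = y} x≤x′ y≤y′ = ≤-trans (+-monoˡ-≤ y x≤x′) (+-monoʳ-≤ x′ y≤y′)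

  x≤y+x : ∀ {x y} → 0# ≤ y → x ≤ y + x
  x≤y+x {x} 0≤y = ≤-respˡ-≡ (+-identityˡ x) (+-monoˡ-≤ x 0≤y)

  -- The strict order is a pair, so without decidable equality a contrapositive of ≤ is
  -- the constructive way to obtain it.
  ≱⇒< : ∀ {x y} → ¬ (y ≤ x) → x < y
  ≱⇒< {x} {y} y≰x with ≤-total x y
  ... | inj₁ x≤y = x≤y , λ { refl → y≰x ≤-refl }
  ... | inj₂ y≤x = ⊥-elim (y≰x y≤x)

module Walks {W : OrderedAbelianGroup} (G : Graph W) where
  open OrderedAbelianGroup W
  open OrderedAbelianGroupProperties W
  open Graph G

  Incident-sym : ∀ {i x y} → Incident G i x y → Incident G i y x
  Incident-sym (inj₁ eq) = inj₂ eq
  Incident-sym (inj₂ eq) = inj₁ eq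

  Incident-ends : ∀ {i x y x′ y′} → Incident G i x y → Incident G i x′ y′ →
                  (x ≡ x′ × y ≡ y′) ⊎ (x ≡ y′ × y ≡ x′)
  Incident-ends (inj₁ p) (inj₁ q) = let eq = trans (sym p) q in inj₁ (,-injectiveˡ eq , ,-injectiveʳ eq)
  Incident-ends (inj₁ p) (inj₂ q) = let eq = trans (sym p) q in inj₂ (,-injectiveˡ eq , ,-injectiveʳ eq)
  Incident-ends (inj₂ p) (inj₁ q) = let eq = trans (sym p) q in inj₂ (,-injectiveʳ eq , ,-injectiveˡ eq)
  Incident-ends (inj₂ p) (inj₂ q) = let eq = trans (sym p) q in inj₁ (,-injectiveʳ eq , ,-injectiveˡ eq)

  infixr 5 _++ʷ_
  _++ʷ_ : ∀ {a x y z} → Walk G a x y → Walk G a y z → Walk G a x z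
  []      ++ʷ q = q
  (i ∷ p) ++ʷ q = i ∷ (p ++ʷ q)

  walkWeight-++ : ∀ {a x y z} (p : Walk G a x y) (q : Walk G a y z) →
                  walkWeight G (p ++ʷ q) ≡ walkWeight G p + walkWeight G q
  walkWeight-++ []            q = sym (+-identityˡ _)
  walkWeight-++ ((i , _) ∷ p) q =
    trans (cong (weight i +_) (walkWeight-++ p q)) (sym (+-assoc _ _ _))

  reverse : ∀ {a x y} → Walk G a x y → Walk G a y x
  reverse []                   = []
  reverse ((i , pr , inc) ∷ p) = reverse p ++ʷ ((i , pr , Incident-sym inc) ∷ [])

  walkWeight-reverse : ∀ {a x y} (p : Walk G a x y) → walkWeight G (reverse p) ≡ walkWeight G p
  walkWeight-reverse [] = refl
  walkWeight-reverse ((i , _) ∷ p) = begin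
    walkWeight G (reverse p ++ʷ _)              ≡⟨ walkWeight-++ (reverse p) _ ⟩
    walkWeight G (reverse p) + (weight i + 0#) ≡⟨ cong₂ _+_ (walkWeight-reverse p) (+-identityʳ _) ⟩
    walkWeight G p + weight i                  ≡⟨ +-comm _ _ ⟩
    weight i + walkWeight G p                  ∎
    where open ≡-Reasoning

  forget : ∀ {e x y} → Walk G (just e) x y → Walk G nothing x y
  forget []                  = []
  forget ((i , _ , inc) ∷ p) = (i , tt , inc) ∷ forget p

  walkWeight-forget : ∀ {e x y} (p : Walk G (just e) x y) → walkWeight G (forget p) ≡ walkWeight G p
  walkWeight-forget []            = refl
  walkWeight-forget ((i , _) ∷ p) = cong (weight i +_) (walkWeight-forget p)

  walkWeight-nonneg : NonNegWeights G → ∀ {a x y} (p : Walk G a x y) → 0# ≤ walkWeight G p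
  walkWeight-nonneg _      []            = ≤-refl
  walkWeight-nonneg nonneg ((i , _) ∷ p) =
    ≤-respˡ-≡ (+-identityˡ 0#) (+-mono-≤ (nonneg i) (walkWeight-nonneg nonneg p))

  module _ {a x y δ} (isDist : IsDist G a x y δ) where

    dist≤walkWeight : (p : Walk G a x y) → δ ≤ walkWeight G p
    dist≤walkWeight = proj₂ isDist

    dist-nonneg : NonNegWeights G → 0# ≤ δ
    dist-nonneg nonneg with proj₁ isDist
    ... | p , refl = walkWeight-nonneg nonneg p

module MarkUpSoundness {W : OrderedAbelianGroup} (G : Graph W) (s : V G) (par : V G → V G)
  (D : Maybe (Fin (Graph.m G)) → V G → V G → OrderedAbelianGroup.Carrier W)
  (pe : V G → Fin (Graph.m G)) (L : List (V G)) where
  open Tree G s par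
  open Run D pe L

  LabelsSound : Labels → Set
  LabelsSound ℓ = ∀ t v → ℓ t ≡ just v → Desc v t × ¬ DistTest v t

  mark-sound : ∀ {ℓ v t} → Desc v t → ¬ DistTest v t → LabelsSound ℓ →
               LabelsSound (ℓ [ t ↦ just v ])
  mark-sound {t = t} d fails sound z v′ eq with z ≟ t | eq
  ... | yes refl | refl = d , fails
  ... | no  _    | eq′  = sound z v′ eq′

  step-sound : ∀ {v t ℓ ℓ′} → Desc v t → Step v t ℓ ℓ′ → LabelsSound ℓ → LabelsSound ℓ′
  step-sound d (dist _)       = λ sound → sound
  step-sound d (anc _ _)      = λ sound → sound
  step-sound d (mark fails _) = mark-sound d fails

  inner-sound : ∀ {v ℓ ts ℓ′} → Inner v ℓ ts ℓ′ → LabelsSound ℓ → LabelsSound ℓ′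
  inner-sound []              sound = sound
  inner-sound (skip _ run)    sound = inner-sound run sound
  inner-sound (proc d st run) sound = inner-sound run (step-sound d st sound)

  outer-sound : ∀ {ℓ vs ℓ′} → Outer ℓ vs ℓ′ → LabelsSound ℓ → LabelsSound ℓ′
  outer-sound []                 sound = sound
  outer-sound (root _ run)       sound = outer-sound run sound
  outer-sound (edge _ inner run) sound = outer-sound run (inner-sound inner sound)

  markUp-sound : ∀ {ℓ} → MarkUp ℓ → LabelsSound ℓ
  markUp-sound run = outer-sound run (λ _ _ ())

module ShortestPathTree {W : OrderedAbelianGroup} (G : Graph W)
  (D : Maybe (Fin (Graph.m G)) → V G → V G → OrderedAbelianGroup.Carrier W)
  (s : V G) (par : V G → V G) (pe : V G → Fin (Graph.m G)) (rank : V G → ℕ)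
  (spt : IsShortestPathTree G D s par pe rank) where
  open OrderedAbelianGroup W
  open OrderedAbelianGroupProperties W
  open Graph G
  open Walks G
  open Tree G s par

  module _ {v} (v≢s : v ≢ s) where
    pe-incident : Incident G (pe v) (par v) v
    pe-incident = proj₁ (spt v v≢s)

    rank-par< : rank (par v) ℕ.< rank v
    rank-par< = proj₁ (proj₂ (spt v v≢s))

    dist-par : D nothing s v ≡ D nothing s (par v) + weight (pe v)
    dist-par = proj₂ (proj₂ (spt v v≢s))

  rank-mono : ∀ {v t} → Desc v t → rank v ℕ.≤ rank t
  rank-mono here         = ℕ.≤-refl
  rank-mono (step t≢s d) = ℕ.≤-trans (rank-mono d) (ℕ.<⇒≤ (rank-par< t≢s))

  ¬par-cycle : ∀ {t v} → t ≢ s → v ≢ s → par t ≡ v → t ≡ par v → ⊥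
  ¬par-cycle {t} {v} t≢s v≢s refl t≡par =
    ℕ.<-asym (rank-par< t≢s) (subst (λ x → rank x ℕ.< rank v) (sym t≡par) (rank-par< v≢s))

  pe-injective : ∀ {t v} → t ≢ s → v ≢ s → pe t ≡ pe v → t ≡ v
  pe-injective {t} t≢s v≢s eq with Incident-ends (pe-incident t≢s)
                                     (subst (λ i → Incident G i _ _) (sym eq) (pe-incident v≢s))
  ... | inj₁ (_ , t≡v)       = t≡v
  ... | inj₂ (par≡v , t≡par) = ⊥-elim (¬par-cycle t≢s v≢s par≡v t≡par)

  record TreePath (v t : V G) : Set where
    field
      length      : Carrier
      path        : Walk G (just (pe v)) t v
      path-weight : walkWeight G path ≡ length
      dist-along  : D nothing s t ≡ D nothing s v + length

  treePath : ∀ {v t} → v ≢ s → Desc v t → TreePath v t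
  treePath v≢s here = record
    { length = 0# ; path = [] ; path-weight = refl ; dist-along = sym (+-identityʳ _) }
  treePath {v} {t} v≢s (step t≢s d) = record
    { length      = weight (pe t) + length
    ; path        = (pe t , pe-avoids , Incident-sym (pe-incident t≢s)) ∷ path
    ; path-weight = cong (weight (pe t) +_) path-weight
    ; dist-along  = begin
        D nothing s t                             ≡⟨ dist-par t≢s ⟩
        D nothing s (par t) + weight (pe t)       ≡⟨ cong (_+ weight (pe t)) dist-along ⟩
        D nothing s v + length + weight (pe t)    ≡⟨ +-assoc _ _ _ ⟩
        D nothing s v + (length + weight (pe t))  ≡⟨ cong (D nothing s v +_) (+-comm _ _) ⟩
        D nothing s v + (weight (pe t) + length)  ∎
    }
    where
    open TreePath (treePath v≢s d)
    open ≡-Reasoning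
    t≢v : t ≢ v
    t≢v refl = ℕ.<-irrefl refl (ℕ.<-≤-trans (rank-par< t≢s) (rank-mono d))
    pe-avoids : pe t ≢ pe v
    pe-avoids eq = t≢v (pe-injective t≢s v≢s eq)

  module _ (nonneg : NonNegWeights G) (isD : IsDistanceFunction G D) where

    distTest-fails⇒dist< : ∀ (L : List (V G)) {v t} → v ≢ s → Desc v t →
                           ¬ Run.DistTest D pe L v t →
                           D (just (pe v)) s t < D nothing s t + D nothing s t
    distTest-fails⇒dist< L {v} {t} v≢s d fails = ≱⇒< λ 2d≤a →
      fails (≤-trans (+-mono-≤ d-s-v≤ d-v-t≤) (≤-respˡ-≡ (sym (+-assoc a X X))
                                                   (+-monoʳ-≤ a (≤-trans X+X≤ 2d≤a))))
      where
      open TreePath (treePath v≢s d) renaming (length to X)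
      a : Carrier
      a = D (just (pe v)) s t

      shortest : Σ (Walk G (just (pe v)) s t) λ p → walkWeight G p ≡ a
      shortest = proj₁ (isD (just (pe v)) s t)

      d-s-v≤ : D (just (pe v)) s v ≤ a + X
      d-s-v≤ = ≤-respʳ-≡ (trans (walkWeight-++ (proj₁ shortest) path)
                                 (cong₂ _+_ (proj₂ shortest) path-weight))
                         (dist≤walkWeight (isD _ s v) (proj₁ shortest ++ʷ path))

      d-v-t≤ : D nothing v t ≤ X
      d-v-t≤ = ≤-respʳ-≡ (trans (walkWeight-forget (reverse path))
                                 (trans (walkWeight-reverse path) path-weight))
                         (dist≤walkWeight (isD nothing v t) (forget (reverse path)))

      X≤ : X ≤ D nothing s t
      X≤ = ≤-respʳ-≡ (sym dist-along) (x≤y+x (dist-nonneg (isD nothing s v) nonneg))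

      X+X≤ : X + X ≤ D nothing s t + D nothing s t
      X+X≤ = +-mono-≤ X≤ X≤

mainTheorem5 : (W : OrderedAbelianGroup) → (G : Graph W) →
    let open OrderedAbelianGroup W
        open Graph G
    in Simple G → NonNegWeights G → TwoEdgeConnected G →
    (D : Maybe (Fin m) → V G → V G → Carrier) → IsDistanceFunction G D →
    (s : V G) (par : V G → V G) (pe : V G → Fin m) (rank : V G → ℕ) →
    IsShortestPathTree G D s par pe rank →
    (L : List (V G)) → Tree.PreOrder G s par s L →
    (ℓ : V G → Maybe (V G)) → Tree.Run.MarkUp G s par D pe L ℓ →
    (v t : V G) → v ≢ s → ℓ t ≡ just v →
    D (just (pe v)) s t < D nothing s t + D nothing s t
mainTheorem5 W G _ nonneg _ D isD s par pe rank spt L _ ℓ run v t v≢s ℓt≡v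
  with MarkUpSoundness.markUp-sound G s par D pe L run t v ℓt≡v
... | t∈Tv , fails =
  ShortestPathTree.distTest-fails⇒dist< G D s par pe rank spt nonneg isD L v≢s t∈Tv fails
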